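{- If a formula $\phi$ of $\mathrm{PL}(\textsc{ne})$ is satisfiable (i.e. $t\models\phi$ for some team $t$ with domain $\supseteq\mathsf{P}(\phi)$), then $\phi$ is satisfied by some team of size at most $|\phi|_{\textsc{ne}}$, the number of occurrences of $\textsc{ne}$ in $\phi$.
   Context: Fix a countably infinite set $\mathsf{Prop}$ of propositional variables. Formulas of $\mathrm{PL}(\textsc{ne})$ are generated by $\phi::=p\mid\neg p\mid\bot\mid\top\mid\textsc{ne}\mid\phi\wedge\phi\mid\phi\vee\phi$ with $p\in\mathsf{Prop}$. $\mathsf{P}(\phi)$ is the set of variables occurring in $\phi$. For $\mathsf{X}\subseteq\mathsf{Prop}$, a team with domain $\mathsf{X}$ is a set $t\subseteq 2^{\mathsf{X}}$ of valuations; its size is its cardinality. Team satisfaction: $t\models p$ iff $v(p)=1$ for all $v\in t$; $t\models\neg p$ iff $v(p)=0$ for all $v\in t$; $t\models\bot$ iff $t=\emptyset$; $t\models\top$ always; $t\models\phi\wedge\psi$ iff $t\models\phi$ and $t\models\psi$; $t\models\phi\vee\psi$ iff there are $s,u\subseteq t$ with $t=s\cup u$, $s\models\phi$, $u\models\psi$; $t\models\textsc{ne}$ iff $t\neq\emptyset$. -}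

module Defs where

import Level
open import Level using (Lift)
open import Function using (_$_)
open import Data.Nat using (ℕ; _+_; _≤_)
open import Data.Bool using (Bool; true; false)
open import Data.Product using (Σ; ∃; _×_; _,_)
open import Data.Sum using (_⊎_)
open import Data.Empty using (⊥)
open import Data.Unit using (⊤)
open import Data.List using (List; length)
open import Data.List.Relation.Unary.Any using (Any)
open import Relation.Binary.PropositionalEquality using (_≡_)

data Form : Set where
  var  : ℕ → Form
  nvar : ℕ → Form
  bot  : Form
  top  : Form
  ne   : Form
  _∧f_ : Form → Form → Form
  _∨f_ : Form → Form → Form

VarSet : Set₁
VarSet = ℕ → Set

_⊆P_ : Form → VarSet → Set
var p  ⊆P X = X p
nvar p ⊆P X = X p
bot    ⊆P X = ⊤
top    ⊆P X = ⊤
ne     ⊆P X = ⊤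
(φ ∧f ψ) ⊆P X = (φ ⊆P X) × (ψ ⊆P X)
(φ ∨f ψ) ⊆P X = (φ ⊆P X) × (ψ ⊆P X)

Val : VarSet → Set
Val X = (p : ℕ) → X p → Bool

_≐_ : {X : VarSet} → Val X → Val X → Set
_≐_ {X} v w = (p : ℕ) (x : X p) → v p x ≡ w p x

Team : VarSet → Set₁
Team X = Val X → Set

Split : {X : VarSet} → Team X → Team X → Team X → Set
Split {X} t s u =
  ((v : Val X) → t v → s v ⊎ u v) × ((v : Val X) → s v → t v) × ((v : Val X) → u v → t v)

_⊨_[_] : {X : VarSet} → Team X → (φ : Form) → φ ⊆P X → Set₁
_⊨_[_] {X} t (var p) x = Lift (Level.suc Level.zero) $ ((v : Val X) → t v → v p x ≡ true)
_⊨_[_] {X} t (nvar p) x = Lift (Level.suc Level.zero) $ ((v : Val X) → t v → v p x ≡ false)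
_⊨_[_] {X} t bot _ = Lift (Level.suc Level.zero) $ ((v : Val X) → t v → ⊥)
_⊨_[_] {X} t top _ = Lift (Level.suc Level.zero) $ ⊤
_⊨_[_] {X} t ne _ = Lift (Level.suc Level.zero) $ ∃ λ (v : Val X) → t v
_⊨_[_] {X} t (φ ∧f ψ) (a , b) = (t ⊨ φ [ a ]) × (t ⊨ ψ [ b ])
_⊨_[_] {X} t (φ ∨f ψ) (a , b) =
  Σ (Team X) λ s → Σ (Team X) λ u → Split t s u × (s ⊨ φ [ a ]) × (u ⊨ ψ [ b ])

neCount : Form → ℕ
neCount (var _)  = 0
neCount (nvar _) = 0
neCount bot      = 0
neCount top      = 0
neCount ne       = 1
neCount (φ ∧f ψ) = neCount φ + neCount ψ
neCount (φ ∨f ψ) = neCount φ + neCount ψ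

Satisfiable : Form → Set₁
Satisfiable φ = Σ VarSet λ X → Σ (φ ⊆P X) λ h → Σ (Team X) λ t → t ⊨ φ [ h ]

-- |t| ≤ k : the team is covered (up to equality of valuations) by a list
-- of at most k valuations.
SizeAtMost : {X : VarSet} → Team X → ℕ → Set
SizeAtMost {X} t k =
  Σ (List (Val X)) λ vs → (length vs ≤ k) × ((v : Val X) → t v → Any (λ w → v ≐ w) vs)

{-# OPTIONS --safe #-}
module Submission where

-- Every formula has a "core" in each team t satisfying it: at most |φ|_ne
-- valuations of t such that every subteam of t containing them still
-- satisfies φ.  Literals and ⊥ are downward closed and need no points, ne
-- needs the one valuation it asserts, a conjunction takes the union of the
-- two cores, and for a disjunction splitting t into s ∪ u a subteam t' is
-- split as (t' ∩ s) ∪ (t' ∩ u).  The team consisting of the core alone is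
-- then the small model.

open import Defs
open import Data.Product using (Σ; _×_; _,_; proj₁; proj₂)
open import Data.Sum using () renaming (map to map-⊎)
open import Data.Nat using (ℕ; _+_; _≤_; z≤n; s≤s)
open import Data.Nat.Properties using (+-mono-≤; ≤-reflexive; ≤-trans)
open import Data.List using (List; []; _∷_; _++_; length)
open import Data.List.Properties using (length-++)
open import Data.List.Relation.Unary.All as All using (All; []; _∷_)
open import Data.List.Relation.Unary.All.Properties using (++⁺; ++⁻ˡ; ++⁻ʳ)
open import Data.List.Relation.Unary.Any as Any using ()
open import Data.List.Membership.Propositional using (_∈_)
open import Data.Unit using (tt)
open import Function using (id)
open import Level using (lift)
open import Relation.Binary.PropositionalEquality using (refl)
open import Relation.Unary using (_⊆_; _∩_)

length-++-≤ : ∀ {A : Set} {m n} (xs ys : List A) →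
  length xs ≤ m → length ys ≤ n → length (xs ++ ys) ≤ m + n
length-++-≤ xs ys xs≤m ys≤n = ≤-trans (≤-reflexive (length-++ xs)) (+-mono-≤ xs≤m ys≤n)

record Core {X : VarSet} (φ : Form) (h : φ ⊆P X) (t : Team X) : Set₁ where
  field
    points     : List (Val X)
    size       : length points ≤ neCount φ
    points⊆t   : All t points
    sufficient : (t' : Team X) → t' ⊆ t → All t' points → t' ⊨ φ [ h ]

open Core

core-downward : {X : VarSet} {φ : Form} {h : φ ⊆P X} {t : Team X} →
  ((t' : Team X) → t' ⊆ t → t' ⊨ φ [ h ]) → Core φ h t
core-downward ⊨φ = record
  { points = [] ; size = z≤n ; points⊆t = [] ; sufficient = λ t' t'⊆t _ → ⊨φ t' t'⊆t }

core-∧ : {X : VarSet} {φ ψ : Form} {a : φ ⊆P X} {b : ψ ⊆P X} {t : Team X} →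
  Core φ a t → Core ψ b t → Core (φ ∧f ψ) (a , b) t
core-∧ c d = record
  { points     = points c ++ points d
  ; size       = length-++-≤ (points c) (points d) (size c) (size d)
  ; points⊆t   = ++⁺ (points⊆t c) (points⊆t d)
  ; sufficient = λ t' t'⊆t cd⊆t' →
      sufficient c t' t'⊆t (++⁻ˡ (points c) cd⊆t') ,
      sufficient d t' t'⊆t (++⁻ʳ (points c) cd⊆t')
  }

core-∨ : {X : VarSet} {φ ψ : Form} {a : φ ⊆P X} {b : ψ ⊆P X} {t s u : Team X} →
  Split t s u → Core φ a s → Core ψ b u → Core (φ ∨f ψ) (a , b) t
core-∨ {s = s} {u} (t⊆s∪u , s⊆t , u⊆t) c d = record
  { points     = points c ++ points d
  ; size       = length-++-≤ (points c) (points d) (size c) (size d)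
  ; points⊆t   = ++⁺ (All.map (s⊆t _) (points⊆t c)) (All.map (u⊆t _) (points⊆t d))
  ; sufficient = λ t' t'⊆t cd⊆t' →
      (t' ∩ s) , (t' ∩ u) ,
      ((λ v t'v → map-⊎ (t'v ,_) (t'v ,_) (t⊆s∪u v (t'⊆t t'v))) , (λ _ → proj₁) , (λ _ → proj₁)) ,
      sufficient c (t' ∩ s) proj₂ (All.zip (++⁻ˡ (points c) cd⊆t' , points⊆t c)) ,
      sufficient d (t' ∩ u) proj₂ (All.zip (++⁻ʳ (points c) cd⊆t' , points⊆t d))
  }

core : {X : VarSet} (φ : Form) (h : φ ⊆P X) (t : Team X) → t ⊨ φ [ h ] → Core φ h t
core (var p)  h t (lift ⊨p)  = core-downward λ t' t'⊆t → lift λ v t'v → ⊨p v (t'⊆t t'v)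
core (nvar p) h t (lift ⊨¬p) = core-downward λ t' t'⊆t → lift λ v t'v → ⊨¬p v (t'⊆t t'v)
core bot      h t (lift ⊨⊥)  = core-downward λ t' t'⊆t → lift λ v t'v → ⊨⊥ v (t'⊆t t'v)
core top      h t _          = core-downward λ _ _ → lift tt
core ne       h t (lift (v , tv)) = record
  { points = v ∷ [] ; size = s≤s z≤n ; points⊆t = tv ∷ []
  ; sufficient = λ { t' _ (t'v ∷ []) → lift (v , t'v) } }
core (φ ∧f ψ) (a , b) t (⊨φ , ⊨ψ) = core-∧ (core φ a t ⊨φ) (core ψ b t ⊨ψ)
core (φ ∨f ψ) (a , b) t (s , u , split , ⊨φ , ⊨ψ) = core-∨ split (core φ a s ⊨φ) (core ψ b u ⊨ψ)

listTeam : {X : VarSet} → List (Val X) → Team X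
listTeam vs v = v ∈ vs

listTeam-sizeAtMost : {X : VarSet} {k : ℕ} (vs : List (Val X)) →
  length vs ≤ k → SizeAtMost (listTeam vs) k
listTeam-sizeAtMost vs vs≤k = vs , vs≤k , λ v v∈vs → Any.map (λ { refl _ _ → refl }) v∈vs

corollary2 : (φ : Form) → Satisfiable φ →
    Σ VarSet λ X → Σ (φ ⊆P X) λ h → Σ (Team X) λ t → (t ⊨ φ [ h ]) × SizeAtMost t (neCount φ)
corollary2 φ (X , h , t , t⊨φ) =
  X , h , listTeam (points c) ,
  sufficient c (listTeam (points c)) (All.lookup (points⊆t c)) (All.tabulate id) ,
  listTeam-sizeAtMost (points c) (size c)
  where
    c : Core φ h t
    c = core φ h t t⊨φ
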